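{- Let $\Gamma$ be a distance-regular graph with minimum eigenvalue $\theta_d$ which is geometric with respect to a set $\mathcal{K}$ of Delsarte cliques, and let $\Gamma'$ be the clique graph of $\Gamma$ with respect to $\mathcal{K}$. Let $C$ be a completely regular code in $\Gamma$ with covering radius $\rho$, distance partition $C_0=C,\dots,C_\rho$, and $\theta_d\in Spec(C)$, and let $C'=\{K\in\mathcal{K}: K\cap C\neq\emptyset\}$. Then the distance partition of the vertex set of $\Gamma'$ with respect to the code $C'$ is given by $C'_i=\{K\in\mathcal{K}: K\subset C_i\cup C_{i+1}\}$, $i\in\{0,\dots,\rho-1\}$.
   Context: A distance-regular graph of valency $k$ and diameter $d$ has distinct eigenvalues $\theta_0=k>\dots>\theta_d$. A Delsarte clique is a clique of size $1-\frac{k}{\theta_d}$. $\Gamma$ is geometric with respect to a set $\mathcal{K}$ of Delsarte cliques if every edge lies in exactly one clique of $\mathcal{K}$. The clique graph $\Gamma'$ has vertex set $\mathcal{K}$, with $K,K'$ adjacent iff $|K\cap K'|=1$. For a code (vertex subset) $C$ of a graph, $C_i$ is the set of vertices at distance exactly $i$ from $C$, the covering radius $\rho$ is the largest $i$ with $C_i\ne\emptyset$, and $\{C_0,\dots,C_\rho\}$ is the distance partition. $C$ is completely regular if there are numbers $\alpha_i,\beta_i,\gamma_i$ such that each vertex of $C_i$ has exactly $\alpha_i,\beta_i,\gamma_i$ neighbours in $C_i,C_{i+1},C_{i-1}$ respectively. $Spec(C)$ is the set of eigenvalues of the tridiagonal $(\rho+1)\times(\rho+1)$ intersection matrix with diagonal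 $\alpha_0,\dots,\alpha_\rho$, superdiagonal $\beta_0,\dots,\beta_{\rho-1}$, subdiagonal $\gamma_1,\dots,\gamma_\rho$. -}

module Defs where

open import Data.Bool using (Bool; true; false; _∧_; _∨_; not; if_then_else_)
open import Data.Nat as ℕ using (ℕ; zero; suc; _≡ᵇ_)
open import Data.Fin using (Fin; zero; suc; toℕ)
open import Data.Integer using (+_)
open import Data.Rational using (ℚ; _/_; 0ℚ; 1ℚ; _+_; _*_; _-_; _≤_)
open import Data.Product using (Σ; ∃; _×_; _,_)
open import Relation.Binary.PropositionalEquality using (_≡_; _≢_)

anyF : ∀ {n} → (Fin n → Bool) → Bool
anyF {zero}  f = false
anyF {suc n} f = f zero ∨ anyF (λ i → f (suc i))

countF : ∀ {n} → (Fin n → Bool) → ℕ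
countF {zero}  f = 0
countF {suc n} f = (if f zero then 1 else 0) ℕ.+ countF (λ i → f (suc i))

sumF : ∀ {n} → (Fin n → ℚ) → ℚ
sumF {zero}  f = 0ℚ
sumF {suc n} f = f zero + sumF (λ i → f (suc i))

ℕtoℚ : ℕ → ℚ
ℕtoℚ k = + k / 1

Mat : ℕ → Set
Mat n = Fin n → Fin n → ℚ

_·_ : ∀ {n} → Mat n → (Fin n → ℚ) → (Fin n → ℚ)
(M · v) i = sumF (λ j → M i j * v j)

dot : ∀ {n} → (Fin n → ℚ) → (Fin n → ℚ) → ℚ
dot u v = sumF (λ i → u i * v i)

IsEigenvalue : ∀ {n} → Mat n → ℚ → Set
IsEigenvalue {n} M θ =
  Σ (Fin n → ℚ) λ v → (Σ (Fin n) λ i → v i ≢ 0ℚ) × (∀ i → (M · v) i ≡ θ * v i)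

-- θ is the minimum eigenvalue of the (symmetric) matrix M:
-- θ is an eigenvalue and no eigenvalue is smaller
-- (Rayleigh: xᵀ M x ≥ θ xᵀ x for all x).
IsMinEigenvalue : ∀ {n} → Mat n → ℚ → Set
IsMinEigenvalue {n} M θ =
  IsEigenvalue M θ × (∀ (x : Fin n → ℚ) → θ * dot x x ≤ dot x (M · x))

record Graph (n : ℕ) : Set where
  field
    adj    : Fin n → Fin n → Bool
    sym    : ∀ x y → adj x y ≡ adj y x
    irrefl : ∀ x → adj x x ≡ false
open Graph public

adjMat : ∀ {n} → Graph n → Mat n
adjMat Γ x y = if adj Γ x y then 1ℚ else 0ℚ

ball : ∀ {n} → (Fin n → Fin n → Bool) → (Fin n → Bool) → ℕ → Fin n → Bool
ball A S zero    y = S y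
ball A S (suc i) y = ball A S i y ∨ anyF (λ z → ball A S i z ∧ A z y)

dist : ∀ {n} → (Fin n → Fin n → Bool) → (Fin n → Bool) → ℕ → Fin n → Bool
dist A S zero    y = S y
dist A S (suc i) y = ball A S (suc i) y ∧ not (ball A S i y)

singleton : ∀ {n} → Fin n → Fin n → Bool
singleton x y = toℕ x ≡ᵇ toℕ y

vdist : ∀ {n} → (Fin n → Fin n → Bool) → ℕ → Fin n → Fin n → Bool
vdist A i x y = dist A (singleton x) i y

Connected : ∀ {n} → Graph n → Set
Connected {n} Γ = ∀ (x y : Fin n) → ∃ λ i → vdist (adj Γ) i x y ≡ true

record IsDRG {n : ℕ} (Γ : Graph n) (d : ℕ) (b c : ℕ → ℕ) : Set where
  field
    connected : Connected Γ
    diam-attained : Σ (Fin n) λ x → Σ (Fin n) λ y → vdist (adj Γ) d x y ≡ true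
    diam-max : ∀ i x y → vdist (adj Γ) i x y ≡ true → i ℕ.≤ d
    b-reg : ∀ i x y → vdist (adj Γ) i x y ≡ true →
            countF (λ z → adj Γ y z ∧ vdist (adj Γ) (suc i) x z) ≡ b i
    c-reg : ∀ i x y → vdist (adj Γ) (suc i) x y ≡ true →
            countF (λ z → adj Γ y z ∧ vdist (adj Γ) i x z) ≡ c (suc i)

IsClique : ∀ {n} → Graph n → (Fin n → Bool) → Set
IsClique Γ K = ∀ x y → K x ≡ true → K y ≡ true → x ≢ y → adj Γ x y ≡ true

-- K is a Delsarte clique: a clique of size 1 - k/θ_d
-- (stated as θ_d ≠ 0 and |K| · θ_d = θ_d - k).
IsDelsarteClique : ∀ {n} → Graph n → (k : ℕ) → (θd : ℚ) → (Fin n → Bool) → Set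
IsDelsarteClique Γ k θd K =
  IsClique Γ K × θd ≢ 0ℚ × (ℕtoℚ (countF K) * θd ≡ θd - ℕtoℚ k)

-- Γ is geometric w.r.t. the set 𝒦 = {K j | j : Fin m} of Delsarte cliques
-- (the family is injective, i.e. really a set of cliques).
record IsGeometric {n m : ℕ} (Γ : Graph n) (k : ℕ) (θd : ℚ)
                   (K : Fin m → Fin n → Bool) : Set where
  field
    distinct : ∀ j j' → (∀ x → K j x ≡ K j' x) → j ≡ j'
    delsarte : ∀ j → IsDelsarteClique Γ k θd (K j)
    edge-in-unique : ∀ x y → adj Γ x y ≡ true →
                     countF (λ j → K j x ∧ K j y) ≡ 1

cliqueAdj : ∀ {n m} → (Fin m → Fin n → Bool) → Fin m → Fin m → Bool
cliqueAdj K j j' = countF (λ x → K j x ∧ K j' x) ≡ᵇ 1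

cliqueCode : ∀ {n m} → (Fin m → Fin n → Bool) → (Fin n → Bool) → Fin m → Bool
cliqueCode K C j = anyF (λ x → K j x ∧ C x)

record CoveringRadius {n : ℕ} (Γ : Graph n) (C : Fin n → Bool) (ρ : ℕ) : Set where
  field
    attained : Σ (Fin n) λ x → dist (adj Γ) C ρ x ≡ true
    maximal  : ∀ i x → dist (adj Γ) C i x ≡ true → i ℕ.≤ ρ

record CompletelyRegular {n : ℕ} (Γ : Graph n) (C : Fin n → Bool) (ρ : ℕ)
                         (α β γ : ℕ → ℕ) : Set where
  field
    α-reg : ∀ i x → i ℕ.≤ ρ → dist (adj Γ) C i x ≡ true →
            countF (λ z → adj Γ x z ∧ dist (adj Γ) C i z) ≡ α i
    β-reg : ∀ i x → i ℕ.≤ ρ → dist (adj Γ) C i x ≡ true →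
            countF (λ z → adj Γ x z ∧ dist (adj Γ) C (suc i) z) ≡ β i
    γ-reg : ∀ i x → suc i ℕ.≤ ρ → dist (adj Γ) C (suc i) x ≡ true →
            countF (λ z → adj Γ x z ∧ dist (adj Γ) C i z) ≡ γ (suc i)

intersectionMatrix : (ρ : ℕ) → (α β γ : ℕ → ℕ) → Mat (suc ρ)
intersectionMatrix ρ α β γ i j =
  if toℕ j ≡ᵇ toℕ i then ℕtoℚ (α (toℕ i))
  else if toℕ j ≡ᵇ suc (toℕ i) then ℕtoℚ (β (toℕ i))
  else if suc (toℕ j) ≡ᵇ toℕ i then ℕtoℚ (γ (toℕ i))
  else 0ℚ

InSpec : (ρ : ℕ) → (α β γ : ℕ → ℕ) → ℚ → Set
InSpec ρ α β γ θ = IsEigenvalue (intersectionMatrix ρ α β γ) θ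

{-# OPTIONS --safe #-}
module Submission where

-- Let L x be the distance from x to C and v a θ-eigenvector of the intersection matrix. Complete
-- regularity says that the layers C_0, …, C_ρ form an equitable partition whose quotient matrix is
-- the intersection matrix, so f x := v (L x) is a θ-eigenvector of Γ. Writing N for the
-- clique–vertex incidence matrix, the Delsarte size of the cliques forces every vertex into exactly
-- −θ cliques, so NᵀN = A − θ I and ‖N f‖² = fᵀ (A − θ I) f = 0: f sums to zero over every clique.
-- Every clique lies in two consecutive layers C_t ∪ C_{t+1}. For the clique of an edge between C_t
-- and C_{t+1} the vanishing sum gives v_t = 0 ⇔ v_{t+1} = 0, so v has no zero entry; hence no clique
-- lies inside a single layer, and each clique has a level t: it lies in C_t ∪ C_{t+1} and meets both.
-- Cliques sharing a vertex have levels differing by at most one, and a clique at level t + 1 shares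
-- exactly one vertex with the clique of an edge going down from its lower layer, so the level of a
-- clique is its distance from C' in the clique graph.

open import Defs hiding (sym)
open import Algebra.Bundles using (CommutativeRing)
open import Data.Bool as Bool using (Bool; true; false; _∧_; _∨_; not; if_then_else_)
open import Data.Bool.Properties using (T-≡; ∨-zeroʳ; ∧-identityʳ; ¬-not; ∧-conicalˡ; ∧-conicalʳ; not-injective)
open import Data.Empty using (⊥; ⊥-elim)
open import Data.Fin using (Fin; zero; suc; toℕ)
open import Data.Fin.Properties as Fin using (punchInᵢ≢i; 0≢1+n; any?)
import Data.Integer as ℤ
import Data.Integer.Properties as ℤ
open import Data.Nat as ℕ using (ℕ; zero; suc; _<_)
open import Data.Nat.DivMod using (_mod_; m≤n⇒m%n≡m)
open import Data.Nat.Divisibility using (∣1⇒≡1)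
import Data.Nat.Properties as ℕ
open import Data.Product using (∃; _×_; _,_; proj₁; proj₂)
open import Data.Rational using (ℚ; mkℚ; ↥_; 0ℚ; 1ℚ; _/_; _+_; _*_; -_; _-_; _≤_; 1/_; ≢-nonZero; nonNegative; nonPositive)
open import Data.Rational.Properties
open import Data.Rational.Solver using (module +-*-Solver)
open import Data.Sum as Sum using (_⊎_; inj₁; inj₂)
open import Data.Vec.Functional using (removeAt)
open import Function.Base using (_∘_)
open import Function.Bundles using (_⇔_; mk⇔; Equivalence)
import Function.Properties.Equivalence as ⇔
open import Relation.Binary.Definitions using (tri<; tri≈; tri>)
open import Relation.Binary.PropositionalEquality
open import Relation.Nullary using (¬_; Dec; yes; no; does; contradiction)
open import Relation.Nullary.Decidable using (dec-true; dec-false; decidable-stable; ¬?; _×-dec_)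

open import Algebra.Properties.Semiring.Sum (CommutativeRing.semiring +-*-commutativeRing)
  using (sum; sum-cong-≗; sum-remove; sum-replicate-zero; ∑-distrib-+; ∑-comm; *-distribˡ-sum; *-distribʳ-sum)
open Equivalence using (to; from)
open +-*-Solver using (solve; _:+_; _:*_; :-_; _:-_; _:=_; con)

∨-true⁻ : ∀ a b → (a ∨ b) ≡ true → a ≡ true ⊎ b ≡ true
∨-true⁻ true  b _ = inj₁ refl
∨-true⁻ false b e = inj₂ e

anyF⁺ : ∀ {n} (f : Fin n → Bool) i → f i ≡ true → anyF f ≡ true
anyF⁺ f zero    e = cong (_∨ anyF (λ i → f (suc i))) e
anyF⁺ f (suc i) e = trans (cong (f zero ∨_) (anyF⁺ (λ i → f (suc i)) i e)) (∨-zeroʳ (f zero))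

anyF⁻ : ∀ {n} (f : Fin n → Bool) → anyF f ≡ true → ∃ λ i → f i ≡ true
anyF⁻ {suc n} f e with ∨-true⁻ (f zero) _ e
... | inj₁ e₀ = zero , e₀
... | inj₂ e₁ = let i , eᵢ = anyF⁻ (λ i → f (suc i)) e₁ in suc i , eᵢ

countF-cong : ∀ {n} {f g : Fin n → Bool} → (∀ i → f i ≡ g i) → countF f ≡ countF g
countF-cong {zero}      eq = refl
countF-cong {suc n} {f} eq rewrite eq zero = cong (_ ℕ.+_) (countF-cong (λ i → eq (suc i)))

countF-none : ∀ {n} (f : Fin n → Bool) → (∀ i → f i ≡ false) → countF f ≡ 0
countF-none {zero}  f none = refl
countF-none {suc n} f none rewrite none zero = countF-none (λ i → f (suc i)) (λ i → none (suc i))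

countF≢0⇒∃ : ∀ {n} (f : Fin n → Bool) → countF f ≢ 0 → ∃ λ i → f i ≡ true
countF≢0⇒∃ {zero}  f c≢0 = ⊥-elim (c≢0 refl)
countF≢0⇒∃ {suc n} f c≢0 with f zero in e
... | true  = zero , e
... | false = let i , eᵢ = countF≢0⇒∃ (λ i → f (suc i)) c≢0 in suc i , eᵢ

∃⇒countF≢0 : ∀ {n} (f : Fin n → Bool) i → f i ≡ true → countF f ≢ 0
∃⇒countF≢0 f zero    e rewrite e = λ ()
∃⇒countF≢0 f (suc i) e with f zero
... | true  = λ ()
... | false = ∃⇒countF≢0 (λ i → f (suc i)) i e

countF≡1⇒unique : ∀ {n} (f : Fin n → Bool) → countF f ≡ 1 →
                  ∀ {i j} → f i ≡ true → f j ≡ true → i ≡ j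
countF≡1⇒unique f c {zero}  {zero}  _  _  = refl
countF≡1⇒unique f c {zero}  {suc j} eᵢ eⱼ rewrite eᵢ =
  ⊥-elim (∃⇒countF≢0 (λ i → f (suc i)) j eⱼ (ℕ.suc-injective c))
countF≡1⇒unique f c {suc i} {zero}  eᵢ eⱼ rewrite eⱼ =
  ⊥-elim (∃⇒countF≢0 (λ i → f (suc i)) i eᵢ (ℕ.suc-injective c))
countF≡1⇒unique f c {suc i} {suc j} eᵢ eⱼ with f zero
... | true  = ⊥-elim (∃⇒countF≢0 (λ i → f (suc i)) i eᵢ (ℕ.suc-injective c))
... | false = cong suc (countF≡1⇒unique (λ i → f (suc i)) c eᵢ eⱼ)

unique⇒countF≡1 : ∀ {n} (f : Fin n → Bool) i → f i ≡ true →
                  (∀ j → f j ≡ true → j ≡ i) → countF f ≡ 1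
unique⇒countF≡1 f zero e unique rewrite e =
  cong suc (countF-none (λ j → f (suc j)) λ j → others (suc j) λ ())
  where
  others : ∀ j → j ≢ zero → f j ≡ false
  others j j≢0 with f j in eⱼ
  ... | true  = ⊥-elim (j≢0 (unique j eⱼ))
  ... | false = refl
unique⇒countF≡1 f (suc i) e unique with f zero in e₀
... | true  = ⊥-elim (0≢1+n (unique zero e₀))
... | false = unique⇒countF≡1 (λ j → f (suc j)) i e (λ j eⱼ → Fin.suc-injective (unique (suc j) eⱼ))

|m-n|≤1 : ∀ {m n} → m ℕ.≤ suc n → n ℕ.≤ suc m → m ≡ n ⊎ m ≡ suc n ⊎ suc m ≡ n
|m-n|≤1 {m} {n} m≤1+n n≤1+m with ℕ.<-cmp m n
... | tri< m<n _ _ = inj₂ (inj₂ (ℕ.≤-antisym m<n n≤1+m))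
... | tri≈ _ m≡n _ = inj₁ m≡n
... | tri> _ _ n<m = inj₂ (inj₁ (ℕ.≤-antisym m≤1+n n<m))

m≤n≤1+m⇒n≡m⊎n≡1+m : ∀ {m n} → m ℕ.≤ n → n ℕ.≤ suc m → n ≡ m ⊎ n ≡ suc m
m≤n≤1+m⇒n≡m⊎n≡1+m m≤n n≤1+m with ℕ.m≤n⇒m<n∨m≡n n≤1+m
... | inj₁ n<1+m = inj₁ (ℕ.≤-antisym (ℕ.≤-pred n<1+m) m≤n)
... | inj₂ n≡1+m = inj₂ n≡1+m

n≡m⊎n≡1+m⇒m≤n≤1+m : ∀ {m n} → n ≡ m ⊎ n ≡ suc m → m ℕ.≤ n × n ℕ.≤ suc m
n≡m⊎n≡1+m⇒m≤n≤1+m (inj₁ refl) = ℕ.≤-refl , ℕ.n≤1+n _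
n≡m⊎n≡1+m⇒m≤n≤1+m (inj₂ refl) = ℕ.n≤1+n _ , ℕ.≤-refl

propagate-⇔ : ∀ {p} {P : ℕ → Set p} {r} → (∀ {t} → suc t ℕ.≤ r → P t ⇔ P (suc t)) →
              ∀ {i j} → i ℕ.≤ r → j ℕ.≤ r → P i → P j
propagate-⇔ {P = P} {r} step {i} {j} i≤r j≤r = up j j≤r ∘ down i i≤r
  where
  down : ∀ i → i ℕ.≤ r → P i → P 0
  down zero    _   p = p
  down (suc i) i<r p = down i (ℕ.<⇒≤ i<r) (from (step i<r) p)
  up : ∀ j → j ℕ.≤ r → P 0 → P j
  up zero    _   p = p
  up (suc j) j<r p = to (step j<r) (up j (ℕ.<⇒≤ j<r) p)

ℕtoℚ-mkℚ : ∀ k → ℕtoℚ k ≡ mkℚ (ℤ.+ k) 0 (λ p → ∣1⇒≡1 (proj₂ p))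
ℕtoℚ-mkℚ k = normalize-coprime _

ℕtoℚ-suc : ∀ k → ℕtoℚ (suc k) ≡ 1ℚ + ℕtoℚ k
ℕtoℚ-suc k = begin
  ℕtoℚ (suc k)                     ≡⟨ cong (λ z → (ℤ.+ 1 ℤ.+ z) / 1) (sym (ℤ.*-identityʳ (ℤ.+ k))) ⟩
  (ℤ.+ 1 ℤ.+ ℤ.+ k ℤ.* ℤ.+ 1) / 1  ≡⟨ cong (1ℚ +_) (sym (ℕtoℚ-mkℚ k)) ⟩
  1ℚ + ℕtoℚ k                      ∎
  where open ≡-Reasoning

ℕtoℚ-+ : ∀ a b → ℕtoℚ (a ℕ.+ b) ≡ ℕtoℚ a + ℕtoℚ b
ℕtoℚ-+ zero    b = sym (+-identityˡ (ℕtoℚ b))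
ℕtoℚ-+ (suc a) b = begin
  ℕtoℚ (suc (a ℕ.+ b))        ≡⟨ ℕtoℚ-suc (a ℕ.+ b) ⟩
  1ℚ + ℕtoℚ (a ℕ.+ b)         ≡⟨ cong (1ℚ +_) (ℕtoℚ-+ a b) ⟩
  1ℚ + (ℕtoℚ a + ℕtoℚ b)      ≡⟨ sym (+-assoc 1ℚ (ℕtoℚ a) (ℕtoℚ b)) ⟩
  1ℚ + ℕtoℚ a + ℕtoℚ b        ≡⟨ cong (_+ ℕtoℚ b) (sym (ℕtoℚ-suc a)) ⟩
  ℕtoℚ (suc a) + ℕtoℚ b       ∎
  where open ≡-Reasoning

ℕtoℚ≡0⇒≡0 : ∀ {k} → ℕtoℚ k ≡ 0ℚ → k ≡ 0
ℕtoℚ≡0⇒≡0 {k} e = ℤ.+-injective (cong ↥_ (trans (sym (ℕtoℚ-mkℚ k)) e))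

p*q≡0⇒p≡0 : ∀ p {q} → q ≢ 0ℚ → p * q ≡ 0ℚ → p ≡ 0ℚ
p*q≡0⇒p≡0 p {q} q≢0 pq≡0 = begin
  p                ≡⟨ sym (*-identityʳ p) ⟩
  p * 1ℚ           ≡⟨ cong (p *_) (sym (*-inverseʳ q)) ⟩
  p * (q * 1/ q)   ≡⟨ sym (*-assoc p q (1/ q)) ⟩
  p * q * 1/ q     ≡⟨ cong (_* 1/ q) pq≡0 ⟩
  0ℚ * 1/ q        ≡⟨ *-zeroˡ (1/ q) ⟩
  0ℚ               ∎
  where open ≡-Reasoning
        instance _ = ≢-nonZero q≢0

p*p≡0⇒p≡0 : ∀ p → p * p ≡ 0ℚ → p ≡ 0ℚ
p*p≡0⇒p≡0 p pp≡0 with p ≟ 0ℚ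
... | yes p≡0 = p≡0
... | no  p≢0 = p*q≡0⇒p≡0 p p≢0 pp≡0

0≤p*p : ∀ p → 0ℚ ≤ p * p
0≤p*p p with ≤-total 0ℚ p
... | inj₁ 0≤p = let instance _ = nonNegative 0≤p in nonNegative⁻¹ (p * p) {{nonNeg*nonNeg⇒nonNeg p p}}
... | inj₂ p≤0 = let instance _ = nonPositive p≤0 in nonNegative⁻¹ (p * p) {{nonPos*nonPos⇒nonPos p p}}

a*p+r≡0⇒p≡0 : ∀ {a p r} → a ≢ 0ℚ → a * p + r ≡ 0ℚ → r ≡ 0ℚ → p ≡ 0ℚ
a*p+r≡0⇒p≡0 {a} {p} {r} a≢0 a*p+r≡0 r≡0 = p*q≡0⇒p≡0 p a≢0 (begin
  p * a        ≡⟨ *-comm p a ⟩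
  a * p        ≡⟨ sym (+-identityʳ (a * p)) ⟩
  a * p + 0ℚ   ≡⟨ cong (a * p +_) (sym r≡0) ⟩
  a * p + r    ≡⟨ a*p+r≡0 ⟩
  0ℚ           ∎)
  where open ≡-Reasoning

ind : Bool → ℚ
ind b = if b then 1ℚ else 0ℚ

ind-∧ : ∀ a b → ind (a ∧ b) ≡ ind a * ind b
ind-∧ true  b = sym (*-identityˡ (ind b))
ind-∧ false b = sym (*-zeroˡ (ind b))

sumF≡sum : ∀ {n} (f : Fin n → ℚ) → sumF f ≡ sum f
sumF≡sum {zero}  f = refl
sumF≡sum {suc n} f = cong (f zero +_) (sumF≡sum (λ i → f (suc i)))

sum-ind : ∀ {n} (g : Fin n → Bool) → sum (λ i → ind (g i)) ≡ ℕtoℚ (countF g)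
sum-ind {zero}  g = refl
sum-ind {suc n} g with g zero
... | true  = trans (cong (1ℚ +_) (sum-ind (λ i → g (suc i)))) (sym (ℕtoℚ-suc (countF (λ i → g (suc i)))))
... | false = trans (+-identityˡ _) (sum-ind (λ i → g (suc i)))

sum-zero : ∀ {n} (f : Fin n → ℚ) → (∀ i → f i ≡ 0ℚ) → sum f ≡ 0ℚ
sum-zero {n} f f≗0 = trans (sum-cong-≗ f≗0) (sum-replicate-zero n)

sum-single : ∀ {n} (f : Fin n → ℚ) i → (∀ j → j ≢ i → f j ≡ 0ℚ) → sum f ≡ f i
sum-single {suc n} f i others = begin
  sum f                        ≡⟨ sum-remove f ⟩
  f i + sum (removeAt f i)     ≡⟨ cong (f i +_) (sum-zero _ (λ j → others _ (punchInᵢ≢i i j))) ⟩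
  f i + 0ℚ                     ≡⟨ +-identityʳ (f i) ⟩
  f i                          ∎
  where open ≡-Reasoning

sum-nonneg : ∀ {n} (f : Fin n → ℚ) → (∀ i → 0ℚ ≤ f i) → 0ℚ ≤ sum f
sum-nonneg {zero}  f 0≤f = ≤-refl
sum-nonneg {suc n} f 0≤f = +-mono-≤ (0≤f zero) (sum-nonneg (λ i → f (suc i)) (λ i → 0≤f (suc i)))

sum-nonneg≡0⇒≡0 : ∀ {n} (f : Fin n → ℚ) → (∀ i → 0ℚ ≤ f i) → sum f ≡ 0ℚ → ∀ i → f i ≡ 0ℚ
sum-nonneg≡0⇒≡0 {suc n} f 0≤f Σf≡0 i = ≤-antisym fᵢ≤0 (0≤f i)
  where
  open ≤-Reasoning
  fᵢ≤0 : f i ≤ 0ℚ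
  fᵢ≤0 = begin
    f i                          ≡⟨ sym (+-identityʳ (f i)) ⟩
    f i + 0ℚ                     ≤⟨ +-monoʳ-≤ (f i) (sum-nonneg (removeAt f i) (λ j → 0≤f _)) ⟩
    f i + sum (removeAt f i)     ≡⟨ sym (sum-remove f) ⟩
    sum f                        ≡⟨ Σf≡0 ⟩
    0ℚ                           ∎

δ : ∀ {n} → Fin n → Fin n → ℚ
δ i j = ind (does (i Fin.≟ j))

sum-δ : ∀ {n} (g : Fin n → ℚ) i → sum (λ j → δ i j * g j) ≡ g i
sum-δ g i = begin
  sum (λ j → δ i j * g j)  ≡⟨ sum-single (λ j → δ i j * g j) i off-diagonal ⟩
  δ i i * g i              ≡⟨ cong (λ b → ind b * g i) (dec-true (i Fin.≟ i) refl) ⟩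
  1ℚ * g i                 ≡⟨ *-identityˡ (g i) ⟩
  g i                      ∎
  where
  open ≡-Reasoning
  off-diagonal : ∀ j → j ≢ i → δ i j * g j ≡ 0ℚ
  off-diagonal j j≢i = trans (cong (λ b → ind b * g j) (dec-false (i Fin.≟ j) (j≢i ∘ sym))) (*-zeroˡ (g j))

module _ {n r} (M : Mat n) (ℓ : Fin n → Fin r) (B : Mat r)
         (equitable : ∀ x t → sum (λ z → M x z * δ (ℓ z) t) ≡ B (ℓ x) t) where

  lift-eigenvector : ∀ θ v → (∀ t → (B · v) t ≡ θ * v t) → ∀ x → (M · (v ∘ ℓ)) x ≡ θ * v (ℓ x)
  lift-eigenvector θ v eig x = begin
    (M · (v ∘ ℓ)) x                                       ≡⟨ sumF≡sum (λ z → M x z * v (ℓ z)) ⟩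
    sum (λ z → M x z * v (ℓ z))                           ≡⟨ sum-cong-≗ (λ z → cong (M x z *_) (sym (sum-δ v (ℓ z)))) ⟩
    sum (λ z → M x z * sum (λ t → δ (ℓ z) t * v t))       ≡⟨ sum-cong-≗ (λ z → *-distribˡ-sum (M x z) (λ t → δ (ℓ z) t * v t)) ⟩
    sum (λ z → sum (λ t → M x z * (δ (ℓ z) t * v t)))     ≡⟨ ∑-comm (λ z t → M x z * (δ (ℓ z) t * v t)) ⟩
    sum (λ t → sum (λ z → M x z * (δ (ℓ z) t * v t)))     ≡⟨ sum-cong-≗ (λ t → sum-cong-≗ (λ z → sym (*-assoc (M x z) (δ (ℓ z) t) (v t)))) ⟩
    sum (λ t → sum (λ z → M x z * δ (ℓ z) t * v t))       ≡⟨ sum-cong-≗ (λ t → sym (*-distribʳ-sum (v t) (λ z → M x z * δ (ℓ z) t))) ⟩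
    sum (λ t → sum (λ z → M x z * δ (ℓ z) t) * v t)       ≡⟨ sum-cong-≗ (λ t → cong (_* v t) (equitable x t)) ⟩
    sum (λ t → B (ℓ x) t * v t)                           ≡⟨ sym (sumF≡sum (λ t → B (ℓ x) t * v t)) ⟩
    (B · v) (ℓ x)                                         ≡⟨ eig (ℓ x) ⟩
    θ * v (ℓ x)                                           ∎
    where open ≡-Reasoning

module _ {m n} (N : Fin m → Fin n → ℚ) (M : Mat n) (θ : ℚ)
         (gram : ∀ x y → sum (λ j → N j x * N j y) ≡ M x y - θ * δ x y) where

  -- ‖N g‖² = gᵀ NᵀN g = gᵀ (M − θ I) g = 0.
  eigenvector⇒incidence-sums≡0 : ∀ g → (∀ x → (M · g) x ≡ θ * g x) → ∀ j → sum (λ x → N j x * g x) ≡ 0ℚ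
  eigenvector⇒incidence-sums≡0 g eig j =
    p*p≡0⇒p≡0 (σ j) (sum-nonneg≡0⇒≡0 (λ j → σ j * σ j) (λ j → 0≤p*p (σ j)) Σσ²≡0 j)
    where
    open ≡-Reasoning
    σ : Fin m → ℚ
    σ j = sum (λ x → N j x * g x)

    kernel : ∀ x → sum (λ y → (M x y - θ * δ x y) * g y) ≡ 0ℚ
    kernel x = begin
      sum (λ y → (M x y - θ * δ x y) * g y)                       ≡⟨ sum-cong-≗ (λ y → solve 4 (λ a t d b → (a :- t :* d) :* b := a :* b :+ (:- t) :* (d :* b)) refl (M x y) θ (δ x y) (g y)) ⟩
      sum (λ y → M x y * g y + - θ * (δ x y * g y))               ≡⟨ ∑-distrib-+ (λ y → M x y * g y) (λ y → - θ * (δ x y * g y)) ⟩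
      sum (λ y → M x y * g y) + sum (λ y → - θ * (δ x y * g y))   ≡⟨ cong₂ _+_ (trans (sym (sumF≡sum (λ y → M x y * g y))) (eig x)) (sym (*-distribˡ-sum (- θ) (λ y → δ x y * g y))) ⟩
      θ * g x + - θ * sum (λ y → δ x y * g y)                     ≡⟨ cong (λ s → θ * g x + - θ * s) (sum-δ g x) ⟩
      θ * g x + - θ * g x                                         ≡⟨ solve 2 (λ t a → t :* a :+ (:- t) :* a := con 0ℚ) refl θ (g x) ⟩
      0ℚ                                                          ∎

    Σσ²≡0 : sum (λ j → σ j * σ j) ≡ 0ℚ
    Σσ²≡0 = begin
      sum (λ j → σ j * σ j)                                                ≡⟨ sum-cong-≗ square ⟩
      sum (λ j → sum (λ x → sum (λ y → N j x * g x * (N j y * g y))))      ≡⟨ ∑-comm (λ j x → sum (λ y → N j x * g x * (N j y * g y))) ⟩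
      sum (λ x → sum (λ j → sum (λ y → N j x * g x * (N j y * g y))))      ≡⟨ sum-cong-≗ (λ x → ∑-comm (λ j y → N j x * g x * (N j y * g y))) ⟩
      sum (λ x → sum (λ y → sum (λ j → N j x * g x * (N j y * g y))))      ≡⟨ sum-cong-≗ (λ x → sum-cong-≗ (pair x)) ⟩
      sum (λ x → sum (λ y → g x * ((M x y - θ * δ x y) * g y)))            ≡⟨ sum-cong-≗ (λ x → trans (sym (*-distribˡ-sum (g x) (λ y → (M x y - θ * δ x y) * g y))) (cong (g x *_) (kernel x))) ⟩
      sum (λ x → g x * 0ℚ)                                                 ≡⟨ sum-zero (λ x → g x * 0ℚ) (λ x → *-zeroʳ (g x)) ⟩
      0ℚ                                                                   ∎
      where
      square : ∀ j → σ j * σ j ≡ sum (λ x → sum (λ y → N j x * g x * (N j y * g y)))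
      square j = trans (*-distribʳ-sum (σ j) (λ x → N j x * g x))
                       (sum-cong-≗ (λ x → *-distribˡ-sum (N j x * g x) (λ y → N j y * g y)))
      pair : ∀ x y → sum (λ j → N j x * g x * (N j y * g y)) ≡ g x * ((M x y - θ * δ x y) * g y)
      pair x y = begin
        sum (λ j → N j x * g x * (N j y * g y))     ≡⟨ sum-cong-≗ (λ j → solve 4 (λ a p b q → a :* p :* (b :* q) := a :* b :* (p :* q)) refl (N j x) (g x) (N j y) (g y)) ⟩
        sum (λ j → N j x * N j y * (g x * g y))     ≡⟨ sym (*-distribʳ-sum (g x * g y) (λ j → N j x * N j y)) ⟩
        sum (λ j → N j x * N j y) * (g x * g y)     ≡⟨ cong (_* (g x * g y)) (gram x y) ⟩
        (M x y - θ * δ x y) * (g x * g y)           ≡⟨ solve 3 (λ e p q → e :* (p :* q) := p :* (e :* q)) refl (M x y - θ * δ x y) (g x) (g y) ⟩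
        g x * ((M x y - θ * δ x y) * g y)           ∎

module _ {n} (A : Fin n → Fin n → Bool) where

  IsDistanceTo : (Fin n → Bool) → (Fin n → ℕ) → Set
  IsDistanceTo S D = ∀ i y → ball A S i y ≡ true ⇔ D y ℕ.≤ i

  module _ {S : Fin n → Bool} where

    ball-step : ∀ i y → ball A S i y ≡ true → ball A S (suc i) y ≡ true
    ball-step i y b = cong (_∨ anyF (λ z → ball A S i z ∧ A z y)) b

    ball-mono : ∀ {i j} y → i ℕ.≤ j → ball A S i y ≡ true → ball A S j y ≡ true
    ball-mono y i≤j = go (ℕ.≤⇒≤′ i≤j)
      where
      go : ∀ {i j} → i ℕ.≤′ j → ball A S i y ≡ true → ball A S j y ≡ true
      go ℕ.≤′-refl            b = b
      go (ℕ.≤′-step {j} i≤′j) b = ball-step j y (go i≤′j b)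

    ball-adj : ∀ i {x y} → ball A S i x ≡ true → A x y ≡ true → ball A S (suc i) y ≡ true
    ball-adj i {x} {y} bₓ xy =
      trans (cong (ball A S i y ∨_) (anyF⁺ (λ z → ball A S i z ∧ A z y) x (cong₂ _∧_ bₓ xy)))
            (∨-zeroʳ (ball A S i y))

    ball⇒nonempty : ∀ i y → ball A S i y ≡ true → ∃ λ c → S c ≡ true
    ball⇒nonempty zero    y b = y , b
    ball⇒nonempty (suc i) y b with ∨-true⁻ (ball A S i y) _ b
    ... | inj₁ bᵢ = ball⇒nonempty i y bᵢ
    ... | inj₂ b′ = let x , p = anyF⁻ (λ z → ball A S i z ∧ A z y) b′ in ball⇒nonempty i x (∧-conicalˡ _ _ p)

    dist⇒ball : ∀ i y → dist A S i y ≡ true → ball A S i y ≡ true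
    dist⇒ball zero    y d = d
    dist⇒ball (suc i) y d = ∧-conicalˡ _ (not (ball A S i y)) d

    dist⇒¬ball : ∀ i y → dist A S (suc i) y ≡ true → ball A S i y ≡ false
    dist⇒¬ball i y d = not-injective (∧-conicalʳ (ball A S (suc i) y) _ d)

    ball∖ball⇒dist : ∀ i y → ball A S (suc i) y ≡ true → ball A S i y ≡ false → dist A S (suc i) y ≡ true
    ball∖ball⇒dist i y b₁ b₀ = trans (cong (λ c → ball A S (suc i) y ∧ not c) b₀) (trans (∧-identityʳ _) b₁)

    dist⇒least : ∀ {s} t y → dist A S t y ≡ true → ball A S s y ≡ true → t ℕ.≤ s
    dist⇒least zero    y d b = ℕ.z≤n
    dist⇒least (suc t) y d b = ℕ.≰⇒> λ s≤t →
      contradiction (trans (sym (ball-mono y s≤t b)) (dist⇒¬ball t y d)) λ ()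

    ball⇒dist : ∀ i y → ball A S i y ≡ true → ∃ λ t → dist A S t y ≡ true
    ball⇒dist zero    y b = zero , b
    ball⇒dist (suc i) y b = by-inner-ball (ball A S i y) refl
      where
      by-inner-ball : ∀ c → ball A S i y ≡ c → ∃ λ t → dist A S t y ≡ true
      by-inner-ball true  bᵢ = ball⇒dist i y bᵢ
      by-inner-ball false bᵢ = suc i , ball∖ball⇒dist i y b bᵢ

    reachable⇒distanceTo : (∀ y → ∃ λ i → ball A S i y ≡ true) → ∃ (IsDistanceTo S)
    reachable⇒distanceTo reach = D , λ i y →
      mk⇔ (dist⇒least (D y) y (D-dist y)) (λ D≤i → ball-mono y D≤i (dist⇒ball (D y) y (D-dist y)))
      where
      nearest : ∀ y → ∃ λ t → dist A S t y ≡ true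
      nearest y = ball⇒dist (proj₁ (reach y)) y (proj₂ (reach y))
      D : Fin n → ℕ
      D y = proj₁ (nearest y)
      D-dist : ∀ y → dist A S (D y) y ≡ true
      D-dist y = proj₂ (nearest y)

    module _ {D : Fin n → ℕ} (isD : IsDistanceTo S D) where

      dist⇔≡ : ∀ i y → dist A S i y ≡ true ⇔ D y ≡ i
      dist⇔≡ zero y =
        mk⇔ (λ d → ℕ.n≤0⇒n≡0 (to (isD 0 y) d)) (λ D≡0 → from (isD 0 y) (ℕ.≤-reflexive D≡0))
      dist⇔≡ (suc i) y = mk⇔ D≡1+i dist1+i
        where
        D≡1+i : dist A S (suc i) y ≡ true → D y ≡ suc i
        D≡1+i d = ℕ.≤-antisym (to (isD (suc i) y) (dist⇒ball (suc i) y d))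
          (ℕ.≰⇒> λ D≤i → contradiction (trans (sym (from (isD i y) D≤i)) (dist⇒¬ball i y d)) λ ())
        dist1+i : D y ≡ suc i → dist A S (suc i) y ≡ true
        dist1+i D≡ = ball∖ball⇒dist i y (from (isD (suc i) y) (ℕ.≤-reflexive D≡))
          (¬-not λ bᵢ → ℕ.1+n≰n (subst (ℕ._≤ i) D≡ (to (isD i y) bᵢ)))

      distance-adj : ∀ {x y} → A x y ≡ true → D y ℕ.≤ suc (D x)
      distance-adj {x} {y} xy = to (isD (suc (D x)) y) (ball-adj (D x) (from (isD (D x) x) ℕ.≤-refl) xy)

      distance-pred : ∀ {i y} → D y ≡ suc i → ∃ λ x → A x y ≡ true × D x ≡ i
      distance-pred {i} {y} D≡ with ∨-true⁻ (ball A S i y) _ (from (isD (suc i) y) (ℕ.≤-reflexive D≡))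
      ... | inj₁ bᵢ = contradiction (subst (ℕ._≤ i) D≡ (to (isD i y) bᵢ)) ℕ.1+n≰n
      ... | inj₂ b  = let x , bₓ∧xy = anyF⁻ _ b
                          xy = ∧-conicalʳ _ _ bₓ∧xy
                      in x , xy , ℕ.≤-antisym (to (isD i x) (∧-conicalˡ _ _ bₓ∧xy))
                                              (ℕ.≤-pred (subst (ℕ._≤ suc (D x)) D≡ (distance-adj xy)))

      distance-attains : ∀ {t y} → t ℕ.≤ D y → ∃ λ x → D x ≡ t
      distance-attains {t} {y} t≤D = descend (D y ℕ.∸ t) y (sym (ℕ.m+[n∸m]≡n t≤D))
        where
        descend : ∀ k y → D y ≡ t ℕ.+ k → ∃ λ x → D x ≡ t
        descend zero    y D≡ = y , trans D≡ (ℕ.+-identityʳ t)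
        descend (suc k) y D≡ = let x , _ , Dx≡ = distance-pred (trans D≡ (ℕ.+-suc t k)) in descend k x Dx≡

  ball-⊆ : ∀ {S S′} → (∀ c → S c ≡ true → S′ c ≡ true) → ∀ i y → ball A S i y ≡ true → ball A S′ i y ≡ true
  ball-⊆ S⊆S′ zero    y b = S⊆S′ y b
  ball-⊆ {S} S⊆S′ (suc i) y b with ∨-true⁻ (ball A S i y) _ b
  ... | inj₁ bᵢ = ball-step i y (ball-⊆ S⊆S′ i y bᵢ)
  ... | inj₂ b′ = let x , p = anyF⁻ (λ z → ball A S i z ∧ A z y) b′
                  in ball-adj i (ball-⊆ S⊆S′ i x (∧-conicalˡ _ _ p)) (∧-conicalʳ _ _ p)

singleton-refl : ∀ {n} (x : Fin n) → singleton x x ≡ true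
singleton-refl x = to T-≡ (ℕ.≡⇒≡ᵇ (toℕ x) (toℕ x) refl)

singleton⇒≡ : ∀ {n} {x y : Fin n} → singleton x y ≡ true → x ≡ y
singleton⇒≡ {x = x} {y} e = Fin.toℕ-injective (ℕ.≡ᵇ⇒≡ (toℕ x) (toℕ y) (from T-≡ e))

connected⇒reachable : ∀ {n} (Γ : Graph n) {S c} → Connected Γ → S c ≡ true → ∀ y → ∃ λ i → ball (adj Γ) S i y ≡ true
connected⇒reachable Γ {S} {c} connected c∈S y =
  let i , d = connected c y
  in i , ball-⊆ (adj Γ) (λ z c≡z → subst (λ w → S w ≡ true) (singleton⇒≡ c≡z) c∈S) i y (dist⇒ball (adj Γ) i y d)

IsDRG⇒regular : ∀ {n} {Γ : Graph n} {d b c} → IsDRG Γ d b c → ∀ x → countF (adj Γ x) ≡ b 0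
IsDRG⇒regular {Γ = Γ} drg x = trans (countF-cong (λ z → at-distance-1 z (adj Γ x z) refl)) (b-reg 0 x x (singleton-refl x))
  where
  open IsDRG drg
  at-distance-1 : ∀ z a → adj Γ x z ≡ a → a ≡ (a ∧ vdist (adj Γ) 1 x z)
  at-distance-1 z false _  = refl
  at-distance-1 z true  xz = sym (ball∖ball⇒dist (adj Γ) {singleton x} 0 z (ball-adj (adj Γ) 0 (singleton-refl x) xz) z≢x)
    where
    z≢x : singleton x z ≡ false
    z≢x = ¬-not λ x≡z →
      contradiction (trans (sym (subst (λ w → adj Γ x w ≡ true) (sym (singleton⇒≡ x≡z)) xz)) (irrefl Γ x)) λ ()

intersectionMatrix-entry : ∀ {ρ} α β γ {c} (i t : Fin (suc ρ)) →
  (toℕ t ≡ toℕ i → c ≡ α (toℕ i)) →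
  (toℕ t ≡ suc (toℕ i) → c ≡ β (toℕ i)) →
  (suc (toℕ t) ≡ toℕ i → c ≡ γ (toℕ i)) →
  (toℕ t ≢ toℕ i → toℕ t ≢ suc (toℕ i) → suc (toℕ t) ≢ toℕ i → c ≡ 0) →
  ℕtoℚ c ≡ intersectionMatrix ρ α β γ i t
intersectionMatrix-entry {ρ} α β γ {c} i t on-diagonal above below elsewhere =
  cases (toℕ t ℕ.≟ toℕ i) (toℕ t ℕ.≟ suc (toℕ i)) (suc (toℕ t) ℕ.≟ toℕ i) on-diagonal above below elsewhere
  where
  cases : ∀ {P Q R : Set} (p? : Dec P) (q? : Dec Q) (r? : Dec R) {a b g} →
          (P → c ≡ a) → (Q → c ≡ b) → (R → c ≡ g) → (¬ P → ¬ Q → ¬ R → c ≡ 0) →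
          ℕtoℚ c ≡ (if does p? then ℕtoℚ a else if does q? then ℕtoℚ b else if does r? then ℕtoℚ g else 0ℚ)
  cases (yes p) _       _       ca _  _  _  = cong ℕtoℚ (ca p)
  cases (no ¬p) (yes q) _       _  cb _  _  = cong ℕtoℚ (cb q)
  cases (no ¬p) (no ¬q) (yes r) _  _  cg _  = cong ℕtoℚ (cg r)
  cases (no ¬p) (no ¬q) (no ¬r) _  _  _  c0 = cong ℕtoℚ (c0 ¬p ¬q ¬r)

cliqueAdj⇔ : ∀ {n m} (K : Fin m → Fin n → Bool) j j′ → cliqueAdj K j j′ ≡ true ⇔ countF (λ x → K j x ∧ K j′ x) ≡ 1
cliqueAdj⇔ K j j′ = mk⇔ (λ e → ℕ.≡ᵇ⇒≡ _ 1 (from T-≡ e)) (λ e → to T-≡ (ℕ.≡⇒≡ᵇ _ 1 e))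

cliquesThrough : ∀ {n m} → (Fin m → Fin n → Bool) → Fin n → ℕ
cliquesThrough K x = countF (λ j → K j x)

module _ {n m} {Γ : Graph n} {k : ℕ} {θ : ℚ} {K : Fin m → Fin n → Bool} (geometric : IsGeometric Γ k θ K) where
  open IsGeometric geometric

  common-cliques : ∀ x y → sum (λ j → ind (K j x) * ind (K j y)) ≡ adjMat Γ x y + δ x y * ℕtoℚ (cliquesThrough K x)
  common-cliques x y = begin
    sum (λ j → ind (K j x) * ind (K j y))             ≡⟨ sum-cong-≗ (λ j → sym (ind-∧ (K j x) (K j y))) ⟩
    sum (λ j → ind (K j x ∧ K j y))                   ≡⟨ sum-ind (λ j → K j x ∧ K j y) ⟩
    ℕtoℚ (countF (λ j → K j x ∧ K j y))               ≡⟨ by-cases (x Fin.≟ y) ⟩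
    adjMat Γ x y + δ x y * ℕtoℚ (cliquesThrough K x)  ∎
    where
    open ≡-Reasoning
    ∧-idem : ∀ a → (a ∧ a) ≡ a
    ∧-idem true  = refl
    ∧-idem false = refl
    by-cases : Dec (x ≡ y) → ℕtoℚ (countF (λ j → K j x ∧ K j y)) ≡ adjMat Γ x y + δ x y * ℕtoℚ (cliquesThrough K x)
    by-cases (yes refl) rewrite irrefl Γ x | dec-true (x Fin.≟ x) refl =
      trans (cong ℕtoℚ (countF-cong (λ j → ∧-idem (K j x)))) (sym (trans (+-identityˡ _) (*-identityˡ _)))
    by-cases (no x≢y) rewrite dec-false (x Fin.≟ y) x≢y =
      trans (by-adjacency (adj Γ x y) refl) (sym (cong (adjMat Γ x y +_) (*-zeroˡ (ℕtoℚ (cliquesThrough K x)))))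
      where
      by-adjacency : ∀ a → adj Γ x y ≡ a → ℕtoℚ (countF (λ j → K j x ∧ K j y)) ≡ adjMat Γ x y + 0ℚ
      by-adjacency true  xy rewrite xy = cong ℕtoℚ (edge-in-unique x y xy)
      by-adjacency false xy rewrite xy = cong ℕtoℚ (countF-none _ no-common)
        where
        no-common : ∀ j → (K j x ∧ K j y) ≡ false
        no-common j with K j x in x∈j | K j y in y∈j
        ... | false | _     = refl
        ... | true  | false = refl
        ... | true  | true  = trans (sym (proj₁ (delsarte j) x y x∈j y∈j x≢y)) xy

  module _ (regular : ∀ x → countF (adj Γ x) ≡ k) (k≢0 : k ≢ 0) where

    cliquesThrough≡-θ : ∀ x → ℕtoℚ (cliquesThrough K x) ≡ - θ
    cliquesThrough≡-θ x = begin
      s                     ≡⟨ solve 2 (λ t s → s := (t :+ s) :+ (:- t)) refl θ s ⟩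
      (θ + s) + - θ         ≡⟨ cong (_+ - θ) (p*q≡0⇒p≡0 (θ + s) (k≢0 ∘ ℕtoℚ≡0⇒≡0) [θ+s]*κ≡0) ⟩
      0ℚ + - θ              ≡⟨ +-identityˡ (- θ) ⟩
      - θ                   ∎
      where
      open ≡-Reasoning
      s κ : ℚ
      s = ℕtoℚ (cliquesThrough K x)
      κ = ℕtoℚ k
      double-count : sum (λ j → ind (K j x) * ℕtoℚ (countF (K j))) ≡ κ + s
      double-count = begin
        sum (λ j → ind (K j x) * ℕtoℚ (countF (K j)))        ≡⟨ sum-cong-≗ (λ j → cong (ind (K j x) *_) (sym (sum-ind (K j)))) ⟩
        sum (λ j → ind (K j x) * sum (λ y → ind (K j y)))    ≡⟨ sum-cong-≗ (λ j → *-distribˡ-sum (ind (K j x)) (λ y → ind (K j y))) ⟩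
        sum (λ j → sum (λ y → ind (K j x) * ind (K j y)))    ≡⟨ ∑-comm (λ j y → ind (K j x) * ind (K j y)) ⟩
        sum (λ y → sum (λ j → ind (K j x) * ind (K j y)))    ≡⟨ sum-cong-≗ (common-cliques x) ⟩
        sum (λ y → adjMat Γ x y + δ x y * s)                 ≡⟨ ∑-distrib-+ (adjMat Γ x) (λ y → δ x y * s) ⟩
        sum (λ y → ind (adj Γ x y)) + sum (λ y → δ x y * s)  ≡⟨ cong₂ _+_ (trans (sum-ind (adj Γ x)) (cong ℕtoℚ (regular x))) (sum-δ (λ _ → s) x) ⟩
        κ + s                                                ∎
      scaled : θ * (κ + s) ≡ s * (θ - κ)
      scaled = begin
        θ * (κ + s)                                          ≡⟨ cong (θ *_) (sym double-count) ⟩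
        θ * sum (λ j → ind (K j x) * ℕtoℚ (countF (K j)))    ≡⟨ *-distribˡ-sum θ (λ j → ind (K j x) * ℕtoℚ (countF (K j))) ⟩
        sum (λ j → θ * (ind (K j x) * ℕtoℚ (countF (K j))))  ≡⟨ sum-cong-≗ (λ j → solve 3 (λ t i c → t :* (i :* c) := i :* (c :* t)) refl θ (ind (K j x)) (ℕtoℚ (countF (K j)))) ⟩
        sum (λ j → ind (K j x) * (ℕtoℚ (countF (K j)) * θ))  ≡⟨ sum-cong-≗ (λ j → cong (ind (K j x) *_) (proj₂ (proj₂ (delsarte j)))) ⟩
        sum (λ j → ind (K j x) * (θ - κ))                    ≡⟨ sym (*-distribʳ-sum (θ - κ) (λ j → ind (K j x))) ⟩
        sum (λ j → ind (K j x)) * (θ - κ)                    ≡⟨ cong (_* (θ - κ)) (sum-ind (λ j → K j x)) ⟩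
        s * (θ - κ)                                          ∎
      [θ+s]*κ≡0 : (θ + s) * κ ≡ 0ℚ
      [θ+s]*κ≡0 = begin
        (θ + s) * κ                        ≡⟨ solve 3 (λ t s c → (t :+ s) :* c := t :* (c :+ s) :- s :* (t :- c)) refl θ s κ ⟩
        θ * (κ + s) - s * (θ - κ)          ≡⟨ cong (_- s * (θ - κ)) scaled ⟩
        s * (θ - κ) - s * (θ - κ)          ≡⟨ +-inverseʳ (s * (θ - κ)) ⟩
        0ℚ                                 ∎

    incidence-gram : ∀ x y → sum (λ j → ind (K j x) * ind (K j y)) ≡ adjMat Γ x y - θ * δ x y
    incidence-gram x y = begin
      sum (λ j → ind (K j x) * ind (K j y))             ≡⟨ common-cliques x y ⟩
      adjMat Γ x y + δ x y * ℕtoℚ (cliquesThrough K x)  ≡⟨ cong (λ s → adjMat Γ x y + δ x y * s) (cliquesThrough≡-θ x) ⟩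
      adjMat Γ x y + δ x y * - θ                        ≡⟨ cong (adjMat Γ x y +_) (trans (sym (neg-distribʳ-* (δ x y) θ)) (cong -_ (*-comm (δ x y) θ))) ⟩
      adjMat Γ x y - θ * δ x y                          ∎
      where open ≡-Reasoning

    clique-sums≡0 : ∀ f → (∀ x → (adjMat Γ · f) x ≡ θ * f x) → ∀ j → sum (λ x → ind (K j x) * f x) ≡ 0ℚ
    clique-sums≡0 = eigenvector⇒incidence-sums≡0 (λ j x → ind (K j x)) (adjMat Γ) θ incidence-gram

    clique-nonempty : Fin n → ∀ j → ∃ λ x → K j x ≡ true
    clique-nonempty x j = countF≢0⇒∃ (K j) λ |K|≡0 →
      k≢0 (ℕ.m+n≡0⇒n≡0 (cliquesThrough K x) (ℕtoℚ≡0⇒≡0 (s+κ≡0 |K|≡0)))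
      where
      open ≡-Reasoning
      s+κ≡0 : countF (K j) ≡ 0 → ℕtoℚ (cliquesThrough K x ℕ.+ k) ≡ 0ℚ
      s+κ≡0 |K|≡0 = begin
        ℕtoℚ (cliquesThrough K x ℕ.+ k)     ≡⟨ ℕtoℚ-+ (cliquesThrough K x) k ⟩
        ℕtoℚ (cliquesThrough K x) + ℕtoℚ k  ≡⟨ cong (_+ ℕtoℚ k) (cliquesThrough≡-θ x) ⟩
        - θ + ℕtoℚ k                        ≡⟨ solve 2 (λ t c → (:- t) :+ c := :- (t :- c)) refl θ (ℕtoℚ k) ⟩
        - (θ - ℕtoℚ k)                      ≡⟨ cong -_ (sym (proj₂ (proj₂ (delsarte j)))) ⟩
        - (ℕtoℚ (countF (K j)) * θ)         ≡⟨ cong (λ c → - (ℕtoℚ c * θ)) |K|≡0 ⟩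
        - (0ℚ * θ)                          ≡⟨ cong -_ (*-zeroˡ θ) ⟩
        0ℚ                                  ∎

module CodeLayers {n} (Γ : Graph n) (connected : Connected Γ) {C : Fin n → Bool} {ρ : ℕ}
                  (covering : CoveringRadius Γ C ρ) where
  open CoveringRadius covering

  private
    A : Fin n → Fin n → Bool
    A = adj Γ
    C-nonempty : ∃ λ c → C c ≡ true
    C-nonempty = let x , d = attained in ball⇒nonempty A ρ x (dist⇒ball A ρ x d)
    distance-to-C : ∃ (IsDistanceTo A C)
    distance-to-C = reachable⇒distanceTo A (connected⇒reachable Γ {C} connected (proj₂ C-nonempty))

  L : Fin n → ℕ
  L = proj₁ distance-to-C

  L-distance : IsDistanceTo A C L
  L-distance = proj₂ distance-to-C

  dist⇔L≡ : ∀ i y → dist A C i y ≡ true ⇔ L y ≡ i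
  dist⇔L≡ = dist⇔≡ A L-distance

  layers⇔dist∨dist : ∀ i x → (L x ≡ i ⊎ L x ≡ suc i) ⇔ (dist A C i x ∨ dist A C (suc i) x) ≡ true
  layers⇔dist∨dist i x = mk⇔
    Sum.[ (λ Lx≡i → cong (_∨ dist A C (suc i) x) (from (dist⇔L≡ i x) Lx≡i))
        , (λ Lx≡1+i → trans (cong (dist A C i x ∨_) (from (dist⇔L≡ (suc i) x) Lx≡1+i)) (∨-zeroʳ (dist A C i x))) ]
    (Sum.map (to (dist⇔L≡ i x)) (to (dist⇔L≡ (suc i) x)) ∘ ∨-true⁻ (dist A C i x) _)

  L≤ρ : ∀ x → L x ℕ.≤ ρ
  L≤ρ x = maximal (L x) x (from (dist⇔L≡ (L x) x) refl)

  layer-nonempty : ∀ {t} → t ℕ.≤ ρ → ∃ λ x → L x ≡ t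
  layer-nonempty t≤ρ =
    let x , d = attained in distance-attains A L-distance (subst (_ ℕ.≤_) (sym (to (dist⇔L≡ ρ x) d)) t≤ρ)

  L-adj : ∀ {x y} → A x y ≡ true → L y ℕ.≤ suc (L x)
  L-adj = distance-adj A L-distance

  L-adj′ : ∀ {x y} → A x y ≡ true → L x ℕ.≤ suc (L y)
  L-adj′ {x} {y} xy = L-adj (trans (Graph.sym Γ y x) xy)

  neighbour-exists : 1 ℕ.≤ ρ → ∃ λ x → countF (A x) ≢ 0
  neighbour-exists 1≤ρ =
    let x , Lx≡ρ = layer-nonempty ℕ.≤-refl
        y , yx , _ = distance-pred A L-distance (trans Lx≡ρ (sym (ℕ.suc-pred ρ {{ℕ.>-nonZero 1≤ρ}})))
    in x , ∃⇒countF≢0 (A x) y (trans (Graph.sym Γ x y) yx)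

  toℕ-mod : ∀ {t} → t ℕ.≤ ρ → toℕ (t mod suc ρ) ≡ t
  toℕ-mod t≤ρ = trans (Fin.toℕ-fromℕ< _) (m≤n⇒m%n≡m t≤ρ)

  ℓ : Fin n → Fin (suc ρ)
  ℓ x = L x mod suc ρ

  module Regular {α β γ : ℕ → ℕ} (completelyRegular : CompletelyRegular Γ C ρ α β γ) where
    open CompletelyRegular completelyRegular

    neighbours-in-layer : ∀ x (t : Fin (suc ρ)) →
      ℕtoℚ (countF (λ z → A x z ∧ dist A C (toℕ t) z)) ≡ intersectionMatrix ρ α β γ (ℓ x) t
    neighbours-in-layer x t = intersectionMatrix-entry α β γ {N (toℕ t)} i t
      (λ t≡i → trans (cong N t≡i) (α-reg (toℕ i) x i≤ρ home))
      (λ t≡1+i → trans (cong N t≡1+i) (β-reg (toℕ i) x i≤ρ home))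
      (λ 1+t≡i → trans (γ-reg (toℕ t) x (subst (ℕ._≤ ρ) (sym 1+t≡i) i≤ρ) (subst (λ a → dist A C a x ≡ true) (sym 1+t≡i) home))
                       (cong γ 1+t≡i))
      (λ t≢i t≢1+i 1+t≢i → countF-none _ λ z → ¬-not λ z∈N → too-far z z∈N t≢i t≢1+i 1+t≢i)
      where
      i = ℓ x
      N : ℕ → ℕ
      N a = countF (λ z → A x z ∧ dist A C a z)
      i≡L : toℕ i ≡ L x
      i≡L = toℕ-mod (L≤ρ x)
      i≤ρ : toℕ i ℕ.≤ ρ
      i≤ρ = subst (ℕ._≤ ρ) (sym i≡L) (L≤ρ x)
      home : dist A C (toℕ i) x ≡ true
      home = from (dist⇔L≡ (toℕ i) x) (sym i≡L)
      too-far : ∀ z → (A x z ∧ dist A C (toℕ t) z) ≡ true →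
                toℕ t ≢ toℕ i → toℕ t ≢ suc (toℕ i) → suc (toℕ t) ≢ toℕ i → ⊥
      too-far z xz∧z∈Cₜ t≢i t≢1+i 1+t≢i = near (|m-n|≤1 (L-adj xz) (L-adj′ xz))
        where
        xz = ∧-conicalˡ _ _ xz∧z∈Cₜ
        Lz≡t = to (dist⇔L≡ (toℕ t) z) (∧-conicalʳ _ _ xz∧z∈Cₜ)
        near : L z ≡ L x ⊎ L z ≡ suc (L x) ⊎ suc (L z) ≡ L x → ⊥
        near (inj₁ Lz≡Lx)          = t≢i (trans (sym Lz≡t) (trans Lz≡Lx (sym i≡L)))
        near (inj₂ (inj₁ Lz≡1+Lx)) = t≢1+i (trans (sym Lz≡t) (trans Lz≡1+Lx (cong suc (sym i≡L))))
        near (inj₂ (inj₂ 1+Lz≡Lx)) = 1+t≢i (trans (cong suc (sym Lz≡t)) (trans 1+Lz≡Lx (sym i≡L)))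

    layer-indicator : ∀ z t → δ (ℓ z) t ≡ ind (dist A C (toℕ t) z)
    layer-indicator z t = cong ind (by-cases (ℓ z Fin.≟ t))
      where
      ℓz≡t⇔ : ℓ z ≡ t ⇔ L z ≡ toℕ t
      ℓz≡t⇔ = mk⇔ (λ e → trans (sym (toℕ-mod (L≤ρ z))) (cong toℕ e))
                  (λ e → Fin.toℕ-injective (trans (toℕ-mod (L≤ρ z)) e))
      by-cases : (d : Dec (ℓ z ≡ t)) → does d ≡ dist A C (toℕ t) z
      by-cases (yes ℓz≡t) = sym (from (dist⇔L≡ (toℕ t) z) (to ℓz≡t⇔ ℓz≡t))
      by-cases (no ℓz≢t)  = sym (¬-not λ d → ℓz≢t (from ℓz≡t⇔ (to (dist⇔L≡ (toℕ t) z) d)))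

    equitable : ∀ x t → sum (λ z → adjMat Γ x z * δ (ℓ z) t) ≡ intersectionMatrix ρ α β γ (ℓ x) t
    equitable x t = begin
      sum (λ z → adjMat Γ x z * δ (ℓ z) t)              ≡⟨ sum-cong-≗ (λ z → trans (cong (ind (A x z) *_) (layer-indicator z t)) (sym (ind-∧ (A x z) _))) ⟩
      sum (λ z → ind (A x z ∧ dist A C (toℕ t) z))      ≡⟨ sum-ind (λ z → A x z ∧ dist A C (toℕ t) z) ⟩
      ℕtoℚ (countF (λ z → A x z ∧ dist A C (toℕ t) z))  ≡⟨ neighbours-in-layer x t ⟩
      intersectionMatrix ρ α β γ (ℓ x) t                ∎
      where open ≡-Reasoning

    module Spectral {θ : ℚ} (spec : InSpec ρ α β γ θ) where

      -- v read off by layer number, so that v ∘ ℓ = u ∘ L.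
      u : ℕ → ℚ
      u t = proj₁ spec (t mod suc ρ)

      layer-eigenvector : ∀ x → (adjMat Γ · (u ∘ L)) x ≡ θ * u (L x)
      layer-eigenvector = lift-eigenvector (adjMat Γ) ℓ (intersectionMatrix ρ α β γ) equitable θ (proj₁ spec) (proj₂ (proj₂ spec))

      u-somewhere≢0 : ∃ λ t → t ℕ.≤ ρ × u t ≢ 0ℚ
      u-somewhere≢0 = toℕ i₀ , i₀≤ρ , subst (λ i → proj₁ spec i ≢ 0ℚ) (sym mod-i₀) v-i₀≢0
        where
        i₀ = proj₁ (proj₁ (proj₂ spec))
        v-i₀≢0 = proj₂ (proj₁ (proj₂ spec))
        i₀≤ρ = ℕ.≤-pred (Fin.toℕ<n i₀)
        mod-i₀ : toℕ i₀ mod suc ρ ≡ i₀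
        mod-i₀ = Fin.toℕ-injective (toℕ-mod i₀≤ρ)

module CliquesOfCode {n m} (Γ : Graph n) (connected : Connected Γ)
  {k : ℕ} (regular : ∀ x → countF (adj Γ x) ≡ k)
  {θ : ℚ} {K : Fin m → Fin n → Bool} (geometric : IsGeometric Γ k θ K)
  {C : Fin n → Bool} {ρ : ℕ} {α β γ : ℕ → ℕ}
  (covering : CoveringRadius Γ C ρ) (completelyRegular : CompletelyRegular Γ C ρ α β γ)
  (spec : InSpec ρ α β γ θ) (1≤ρ : 1 ℕ.≤ ρ) where

  open CodeLayers Γ connected covering
  open Regular completelyRegular
  open Spectral {θ} spec
  open IsGeometric geometric

  private
    A : Fin n → Fin n → Bool
    A = adj Γ
    A′ : Fin m → Fin m → Bool
    A′ = cliqueAdj K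
    C′ : Fin m → Bool
    C′ = cliqueCode K C

  k≢0 : k ≢ 0
  k≢0 k≡0 = let x , deg≢0 = neighbour-exists 1≤ρ in deg≢0 (trans (regular x) k≡0)

  σ : Fin m → ℚ
  σ j = sum (λ x → ind (K j x) * u (L x))

  σ≡0 : ∀ j → σ j ≡ 0ℚ
  σ≡0 = clique-sums≡0 geometric regular k≢0 (u ∘ L) layer-eigenvector

  edge-clique : ∀ {x y} → A x y ≡ true → ∃ λ j → K j x ≡ true × K j y ≡ true
  edge-clique {x} {y} xy =
    let j , x∈j∧y∈j = countF≢0⇒∃ (λ j → K j x ∧ K j y) (λ c≡0 → ℕ.1+n≢0 (trans (sym (edge-in-unique x y xy)) c≡0))
    in j , ∧-conicalˡ _ _ x∈j∧y∈j , ∧-conicalʳ (K j x) _ x∈j∧y∈j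

  clique-close : ∀ {j x y} → K j x ≡ true → K j y ≡ true → L y ℕ.≤ suc (L x)
  clique-close {j} {x} {y} x∈j y∈j with x Fin.≟ y
  ... | yes refl = ℕ.n≤1+n (L x)
  ... | no  x≢y  = L-adj (proj₁ (delsarte j) x y x∈j y∈j x≢y)

  InLayers : Fin m → ℕ → Set
  InLayers j t = ∀ x → K j x ≡ true → L x ≡ t ⊎ L x ≡ suc t

  InLayers⇔dist∨dist : ∀ j i → InLayers j i ⇔ (∀ x → K j x ≡ true → (dist A C i x ∨ dist A C (suc i) x) ≡ true)
  InLayers⇔dist∨dist j i = mk⇔ (λ within x x∈j → to (layers⇔dist∨dist i x) (within x x∈j))
                      (λ covered x x∈j → from (layers⇔dist∨dist i x) (covered x x∈j))

  clique-between : ∀ {j x y t} → K j x ≡ true → K j y ≡ true → L x ≡ t → L y ≡ suc t → InLayers j t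
  clique-between {x = x} {y} {t} x∈j y∈j Lx≡t Ly≡1+t w w∈j = m≤n≤1+m⇒n≡m⊎n≡1+m
    (ℕ.≤-pred (subst (ℕ._≤ suc (L w)) Ly≡1+t (clique-close w∈j y∈j)))
    (subst (λ s → L w ℕ.≤ suc s) Lx≡t (clique-close x∈j w∈j))

  layer-split : ∀ {j t} → InLayers j t → ∀ x →
    ind (K j x) * u (L x) ≡ ind (K j x ∧ dist A C t x) * u t + ind (K j x ∧ dist A C (suc t) x) * u (suc t)
  layer-split {j} {t} within x = by-membership (K j x) refl
    where
    open ≡-Reasoning
    by-membership : ∀ b → K j x ≡ b →
      ind b * u (L x) ≡ ind (b ∧ dist A C t x) * u t + ind (b ∧ dist A C (suc t) x) * u (suc t)
    by-membership false _ =
      trans (*-zeroˡ (u (L x))) (sym (trans (cong₂ _+_ (*-zeroˡ (u t)) (*-zeroˡ (u (suc t)))) (+-identityˡ 0ℚ)))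
    by-membership true x∈j with within x x∈j
    ... | inj₁ Lx≡t rewrite from (dist⇔L≡ t x) Lx≡t
                          | ¬-not {dist A C (suc t) x} (λ d → ℕ.1+n≢n (sym (trans (sym Lx≡t) (to (dist⇔L≡ (suc t) x) d)))) = begin
      1ℚ * u (L x)               ≡⟨ *-identityˡ (u (L x)) ⟩
      u (L x)                    ≡⟨ cong u Lx≡t ⟩
      u t                        ≡⟨ sym (+-identityʳ (u t)) ⟩
      u t + 0ℚ                   ≡⟨ sym (cong₂ _+_ (*-identityˡ (u t)) (*-zeroˡ (u (suc t)))) ⟩
      1ℚ * u t + 0ℚ * u (suc t)  ∎
    ... | inj₂ Lx≡1+t rewrite from (dist⇔L≡ (suc t) x) Lx≡1+t
                            | ¬-not {dist A C t x} (λ d → ℕ.1+n≢n (sym (trans (sym (to (dist⇔L≡ t x) d)) Lx≡1+t))) = begin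
      1ℚ * u (L x)               ≡⟨ *-identityˡ (u (L x)) ⟩
      u (L x)                    ≡⟨ cong u Lx≡1+t ⟩
      u (suc t)                  ≡⟨ sym (+-identityˡ (u (suc t))) ⟩
      0ℚ + u (suc t)             ≡⟨ sym (cong₂ _+_ (*-zeroˡ (u t)) (*-identityˡ (u (suc t)))) ⟩
      0ℚ * u t + 1ℚ * u (suc t)  ∎

  clique-sum : ∀ {j t} → InLayers j t →
    σ j ≡ ℕtoℚ (countF (λ x → K j x ∧ dist A C t x)) * u t + ℕtoℚ (countF (λ x → K j x ∧ dist A C (suc t) x)) * u (suc t)
  clique-sum {j} {t} within = begin
    σ j                                ≡⟨ sum-cong-≗ (layer-split within) ⟩
    sum (λ x → part t x + part (suc t) x)  ≡⟨ ∑-distrib-+ (part t) (part (suc t)) ⟩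
    sum (part t) + sum (part (suc t))  ≡⟨ cong₂ _+_ (counted t) (counted (suc t)) ⟩
    ℕtoℚ (countF (λ x → K j x ∧ dist A C t x)) * u t + ℕtoℚ (countF (λ x → K j x ∧ dist A C (suc t) x)) * u (suc t) ∎
    where
    open ≡-Reasoning
    part : ℕ → Fin n → ℚ
    part s x = ind (K j x ∧ dist A C s x) * u s
    counted : ∀ s → sum (part s) ≡ ℕtoℚ (countF (λ x → K j x ∧ dist A C s x)) * u s
    counted s = trans (sym (*-distribʳ-sum (u s) (λ x → ind (K j x ∧ dist A C s x))))
                      (cong (_* u s) (sum-ind (λ x → K j x ∧ dist A C s x)))

  layer-count≢0 : ∀ {j s} → (∃ λ x → K j x ≡ true × L x ≡ s) → ℕtoℚ (countF (λ w → K j w ∧ dist A C s w)) ≢ 0ℚ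
  layer-count≢0 {j} {s} (x , x∈j , Lx≡s) = ∃⇒countF≢0 _ x (cong₂ _∧_ x∈j (from (dist⇔L≡ s x) Lx≡s)) ∘ ℕtoℚ≡0⇒≡0

  record Straddles (j : Fin m) (t : ℕ) : Set where
    field
      within : InLayers j t
      lower  : ∃ λ x → K j x ≡ true × L x ≡ t
      upper  : ∃ λ x → K j x ≡ true × L x ≡ suc t

  straddles-edge : ∀ {j x y t} → K j x ≡ true → K j y ≡ true → L x ≡ t → L y ≡ suc t → Straddles j t
  straddles-edge x∈j y∈j Lx≡t Ly≡1+t = record
    { within = clique-between x∈j y∈j Lx≡t Ly≡1+t
    ; lower  = _ , x∈j , Lx≡t
    ; upper  = _ , y∈j , Ly≡1+t
    }

  crossing-clique : ∀ {x y t} → A x y ≡ true → L x ≡ t → L y ≡ suc t → ∃ λ j → K j y ≡ true × Straddles j t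
  crossing-clique xy Lx≡t Ly≡1+t =
    let j , x∈j , y∈j = edge-clique xy in j , y∈j , straddles-edge x∈j y∈j Lx≡t Ly≡1+t

  u≡0⇔u[1+]≡0 : ∀ {t} → suc t ℕ.≤ ρ → u t ≡ 0ℚ ⇔ u (suc t) ≡ 0ℚ
  u≡0⇔u[1+]≡0 {t} 1+t≤ρ = mk⇔
    (λ uₜ≡0 → a*p+r≡0⇒p≡0 (layer-count≢0 upper) (trans (+-comm (b * u (suc t)) (a * u t)) σⱼ≡0) (trans (cong (a *_) uₜ≡0) (*-zeroʳ a)))
    (λ u₁≡0 → a*p+r≡0⇒p≡0 (layer-count≢0 lower) σⱼ≡0 (trans (cong (b *_) u₁≡0) (*-zeroʳ b)))
    where
    above = layer-nonempty 1+t≤ρ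
    below = distance-pred A L-distance (proj₂ above)
    crossing = crossing-clique (proj₁ (proj₂ below)) (proj₂ (proj₂ below)) (proj₂ above)
    j = proj₁ crossing
    open Straddles (proj₂ (proj₂ crossing))
    a b : ℚ
    a = ℕtoℚ (countF (λ w → K j w ∧ dist A C t w))
    b = ℕtoℚ (countF (λ w → K j w ∧ dist A C (suc t) w))
    σⱼ≡0 : a * u t + b * u (suc t) ≡ 0ℚ
    σⱼ≡0 = trans (sym (clique-sum within)) (σ≡0 j)

  u≢0 : ∀ {t} → t ℕ.≤ ρ → u t ≢ 0ℚ
  u≢0 t≤ρ uₜ≡0 =
    let t₀ , t₀≤ρ , u₀≢0 = u-somewhere≢0
    in u₀≢0 (propagate-⇔ {P = λ s → u s ≡ 0ℚ} u≡0⇔u[1+]≡0 t≤ρ t₀≤ρ uₜ≡0)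

  straddles-pair : ∀ {j x y} → K j x ≡ true → K j y ≡ true → L x ≢ L y → ∃ (Straddles j)
  straddles-pair {j} {x} {y} x∈j y∈j Lx≢Ly = by-position (|m-n|≤1 (clique-close x∈j y∈j) (clique-close y∈j x∈j))
    where
    by-position : L y ≡ L x ⊎ L y ≡ suc (L x) ⊎ suc (L y) ≡ L x → ∃ (Straddles j)
    by-position (inj₁ Ly≡Lx)          = ⊥-elim (Lx≢Ly (sym Ly≡Lx))
    by-position (inj₂ (inj₁ Ly≡1+Lx)) = L x , straddles-edge x∈j y∈j refl Ly≡1+Lx
    by-position (inj₂ (inj₂ 1+Ly≡Lx)) = L y , straddles-edge y∈j x∈j refl (sym 1+Ly≡Lx)

  straddles : ∀ j → ∃ (Straddles j)
  straddles j = by-decision (any? λ w → (K j w Bool.≟ true) ×-dec ¬? (L w ℕ.≟ L x₀))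
    where
    x₀-in-j = clique-nonempty geometric regular k≢0 (proj₁ (layer-nonempty ℕ.z≤n)) j
    x₀ = proj₁ x₀-in-j
    x₀∈j = proj₂ x₀-in-j
    by-decision : Dec (∃ λ w → K j w ≡ true × L w ≢ L x₀) → ∃ (Straddles j)
    by-decision (yes (w , w∈j , Lw≢Lx₀)) = straddles-pair x₀∈j w∈j (Lw≢Lx₀ ∘ sym)
    by-decision (no one-layer) = ⊥-elim (u≢0 (L≤ρ x₀) u₀≡0)
      where
      same : ∀ w → K j w ≡ true → L w ≡ L x₀
      same w w∈j = decidable-stable (L w ℕ.≟ L x₀) (λ Lw≢Lx₀ → one-layer (w , w∈j , Lw≢Lx₀))
      upper-empty : countF (λ w → K j w ∧ dist A C (suc (L x₀)) w) ≡ 0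
      upper-empty = countF-none _ λ w → ¬-not λ w∈upper →
        ℕ.1+n≢n (trans (sym (to (dist⇔L≡ _ w) (∧-conicalʳ (K j w) _ w∈upper))) (same w (∧-conicalˡ _ _ w∈upper)))
      -- σ j = |K j| · u (L x₀), so a clique inside one layer would make u vanish there.
      u₀≡0 : u (L x₀) ≡ 0ℚ
      u₀≡0 = a*p+r≡0⇒p≡0 (layer-count≢0 (x₀ , x₀∈j , refl))
        (trans (sym (clique-sum (λ w w∈j → inj₁ (same w w∈j)))) (σ≡0 j))
        (trans (cong (λ c → ℕtoℚ c * u (suc (L x₀))) upper-empty) (*-zeroˡ (u (suc (L x₀)))))

  straddles-unique : ∀ {j t s} → Straddles j t → InLayers j s → t ≡ s
  straddles-unique {t = t} {s} str in-s = compare (in-s x x∈j) (in-s y y∈j)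
    where
    open Straddles str using (lower; upper)
    x = proj₁ lower
    x∈j = proj₁ (proj₂ lower)
    Lx≡t = proj₂ (proj₂ lower)
    y = proj₁ upper
    y∈j = proj₁ (proj₂ upper)
    Ly≡1+t = proj₂ (proj₂ upper)
    compare : L x ≡ s ⊎ L x ≡ suc s → L y ≡ s ⊎ L y ≡ suc s → t ≡ s
    compare (inj₁ Lx≡s)   _             = trans (sym Lx≡t) Lx≡s
    compare (inj₂ Lx≡1+s) (inj₁ Ly≡s)   =
      ⊥-elim (ℕ.m≢1+n+m s (trans (sym Ly≡s) (trans Ly≡1+t (cong suc (trans (sym Lx≡t) Lx≡1+s)))))
    compare (inj₂ _)      (inj₂ Ly≡1+s) = ℕ.suc-injective (trans (sym Ly≡1+t) Ly≡1+s)

  lowerLayer : Fin m → ℕ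
  lowerLayer j = proj₁ (straddles j)

  lowerLayer-straddles : ∀ j → Straddles j (lowerLayer j)
  lowerLayer-straddles j = proj₂ (straddles j)

  InLayers⇔lowerLayer≡ : ∀ j t → InLayers j t ⇔ lowerLayer j ≡ t
  InLayers⇔lowerLayer≡ j t = mk⇔ (straddles-unique (lowerLayer-straddles j))
                                 (λ T≡t → subst (InLayers j) T≡t (Straddles.within (lowerLayer-straddles j)))

  lowerLayer-bounds : ∀ {j x} → K j x ≡ true → lowerLayer j ℕ.≤ L x × L x ℕ.≤ suc (lowerLayer j)
  lowerLayer-bounds {j} {x} x∈j = n≡m⊎n≡1+m⇒m≤n≤1+m (Straddles.within (lowerLayer-straddles j) x x∈j)

  adjacent-cliques : ∀ {j j′} → A′ j′ j ≡ true → lowerLayer j ℕ.≤ suc (lowerLayer j′)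
  adjacent-cliques {j} {j′} j′j = ℕ.≤-trans (proj₁ (lowerLayer-bounds x∈j)) (proj₂ (lowerLayer-bounds x∈j′))
    where
    meet-once : countF (λ x → K j′ x ∧ K j x) ≡ 1
    meet-once = to (cliqueAdj⇔ K j′ j) j′j
    shared = countF≢0⇒∃ (λ x → K j′ x ∧ K j x) (λ c≡0 → ℕ.1+n≢0 (trans (sym meet-once) c≡0))
    x = proj₁ shared
    x∈j′ : K j′ x ≡ true
    x∈j′ = ∧-conicalˡ _ _ (proj₂ shared)
    x∈j : K j x ≡ true
    x∈j = ∧-conicalʳ (K j′ x) _ (proj₂ shared)

  clique-below : ∀ {j i} → lowerLayer j ≡ suc i → ∃ λ j′ → lowerLayer j′ ≡ i × A′ j′ j ≡ true
  clique-below {j} {i} T≡1+i = j′ , T′≡i , from (cliqueAdj⇔ K j′ j) meet-once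
    where
    open Straddles (lowerLayer-straddles j) using (lower)
    w = proj₁ lower
    w∈j = proj₁ (proj₂ lower)
    Lw≡1+i : L w ≡ suc i
    Lw≡1+i = trans (proj₂ (proj₂ lower)) T≡1+i
    below = distance-pred A L-distance Lw≡1+i
    crossing = crossing-clique (proj₁ (proj₂ below)) (proj₂ (proj₂ below)) Lw≡1+i
    j′ = proj₁ crossing
    w∈j′ = proj₁ (proj₂ crossing)
    T′≡i : lowerLayer j′ ≡ i
    T′≡i = straddles-unique (lowerLayer-straddles j′) (Straddles.within (proj₂ (proj₂ crossing)))
    -- A second common vertex x would put the edge w x into both cliques, forcing j′ = j.
    only-w : ∀ x → (K j′ x ∧ K j x) ≡ true → x ≡ w
    only-w x x∈j′∧x∈j = decidable-stable (x Fin.≟ w) λ x≢w →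
      let x∈j′ = ∧-conicalˡ _ _ x∈j′∧x∈j
          x∈j  = ∧-conicalʳ (K j′ x) _ x∈j′∧x∈j
          wx   = proj₁ (delsarte j) w x w∈j x∈j (x≢w ∘ sym)
          j′≡j = countF≡1⇒unique (λ j → K j w ∧ K j x) (edge-in-unique w x wx) (cong₂ _∧_ w∈j′ x∈j′) (cong₂ _∧_ w∈j x∈j)
      in ℕ.1+n≢n (trans (sym T≡1+i) (trans (cong lowerLayer (sym j′≡j)) T′≡i))
    meet-once : countF (λ x → K j′ x ∧ K j x) ≡ 1
    meet-once = unique⇒countF≡1 (λ x → K j′ x ∧ K j x) w (cong₂ _∧_ w∈j′ w∈j) only-w

  ball⇒lowerLayer≤ : ∀ i j → ball A′ C′ i j ≡ true → lowerLayer j ℕ.≤ i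
  ball⇒lowerLayer≤ zero j b = ℕ.≤-trans (proj₁ (lowerLayer-bounds x∈j)) (ℕ.≤-reflexive (to (dist⇔L≡ 0 x) x∈C))
    where
    meets-C = anyF⁻ (λ x → K j x ∧ C x) b
    x = proj₁ meets-C
    x∈j = ∧-conicalˡ _ _ (proj₂ meets-C)
    x∈C = ∧-conicalʳ (K j x) _ (proj₂ meets-C)
  ball⇒lowerLayer≤ (suc i) j b = by-step (∨-true⁻ (ball A′ C′ i j) _ b)
    where
    by-step : ball A′ C′ i j ≡ true ⊎ anyF (λ z → ball A′ C′ i z ∧ A′ z j) ≡ true → lowerLayer j ℕ.≤ suc i
    by-step (inj₁ bᵢ) = ℕ.m≤n⇒m≤1+n (ball⇒lowerLayer≤ i j bᵢ)
    by-step (inj₂ b′) = ℕ.≤-trans (adjacent-cliques (∧-conicalʳ (ball A′ C′ i j′) _ bⱼ′∧j′j))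
                                  (ℕ.s≤s (ball⇒lowerLayer≤ i j′ (∧-conicalˡ _ _ bⱼ′∧j′j)))
      where
      j′ = proj₁ (anyF⁻ (λ z → ball A′ C′ i z ∧ A′ z j) b′)
      bⱼ′∧j′j = proj₂ (anyF⁻ (λ z → ball A′ C′ i z ∧ A′ z j) b′)

  lowerLayer≤⇒ball : ∀ i j → lowerLayer j ℕ.≤ i → ball A′ C′ i j ≡ true
  lowerLayer≤⇒ball zero j T≤0 = anyF⁺ (λ x → K j x ∧ C x) w
    (cong₂ _∧_ w∈j (from (dist⇔L≡ 0 w) (trans Lw≡T (ℕ.n≤0⇒n≡0 T≤0))))
    where
    open Straddles (lowerLayer-straddles j) using (lower)
    w = proj₁ lower
    w∈j = proj₁ (proj₂ lower)
    Lw≡T = proj₂ (proj₂ lower)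
  lowerLayer≤⇒ball (suc i) j T≤1+i = by-cases (ℕ.m≤n⇒m<n∨m≡n T≤1+i)
    where
    by-cases : lowerLayer j ℕ.< suc i ⊎ lowerLayer j ≡ suc i → ball A′ C′ (suc i) j ≡ true
    by-cases (inj₁ T≤i)   = ball-step A′ i j (lowerLayer≤⇒ball i j (ℕ.≤-pred T≤i))
    by-cases (inj₂ T≡1+i) =
      let j′ , T′≡i , j′j = clique-below T≡1+i
      in ball-adj A′ i (lowerLayer≤⇒ball i j′ (ℕ.≤-reflexive T′≡i)) j′j

  lowerLayer-distance : IsDistanceTo A′ C′ lowerLayer
  lowerLayer-distance i j = mk⇔ (ball⇒lowerLayer≤ i j) (lowerLayer≤⇒ball i j)

lemma1 : ∀ {n m : ℕ} (Γ : Graph n) (d : ℕ) (b c : ℕ → ℕ) → IsDRG Γ d b c →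
         (θd : ℚ) → IsMinEigenvalue (adjMat Γ) θd →
         (K : Fin m → Fin n → Bool) → IsGeometric Γ (b 0) θd K →
         (C : Fin n → Bool) (ρ : ℕ) (α β γ : ℕ → ℕ) →
         CoveringRadius Γ C ρ → CompletelyRegular Γ C ρ α β γ →
         InSpec ρ α β γ θd →
         ∀ (i : ℕ) → i < ρ → ∀ (j : Fin m) →
         (dist (cliqueAdj K) (cliqueCode K C) i j ≡ true ⇔
          (∀ (x : Fin n) → K j x ≡ true →
             (dist (adj Γ) C i x ∨ dist (adj Γ) C (suc i) x) ≡ true))
lemma1 Γ d b c drg θd _ K geometric C ρ α β γ covering completelyRegular spec i i<ρ j =
  ⇔.trans (dist⇔≡ (cliqueAdj K) lowerLayer-distance i j)
          (⇔.trans (⇔.sym (InLayers⇔lowerLayer≡ j i)) (InLayers⇔dist∨dist j i))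
  where
  open CliquesOfCode Γ (IsDRG.connected drg) (IsDRG⇒regular drg) geometric covering completelyRegular spec
                     (ℕ.≤-trans (ℕ.s≤s ℕ.z≤n) i<ρ)
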